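{- Let $(h,\gamma,\gamma')$ be a coherent triple with gene $\mathbb X=(X_i)_{i\in\mathbb Z}$ and digit sequence $(v_i)_{i\in\mathbb Z}$. For every integer $i$, we have $X_i=\mathbf 0$ if and only if $\sum_{j=0}^{2f-1}p^{2f-1-j}v_{i+j}\ge\frac{q^2-1}{p-1}$.
   Context: Let $p>2$ be a prime, $f\ge2$ an integer, $q=p^f$. A coherent triple is $(h,\gamma,\gamma')\in\mathbb Z/(q^2-1)\mathbb Z\times\mathbb Z/(q-1)\mathbb Z\times\mathbb Z/(q-1)\mathbb Z$ such that $h$ is not divisible by $q+1$ and $h\equiv\gamma+\gamma'+\frac{q-1}{p-1}\pmod{q-1}$. Gene of a coherent triple (values in the symbols $\{\mathbf A,\mathbf B,\mathbf{AB},\mathbf 0\}$). Fix integer representatives of $h,\gamma'$. Let $h_0,\dots,h_{f-1}\in\{0,\dots,p-1\}$ with $h\equiv 1+\sum_{i=0}^{f-1}h_ip^{f-1-i}\pmod{q+1}$, set $h_i=p-1-h_{i-f}$ for $f\le i\le 2f-1$, extend $2f$-periodically, and set $\iota_i=1$ if $h_i=p-1$, $\iota_i=0$ otherwise. Let $\nu=p^{f-1}+\dots+p$. For $0\le i\le 2f-1$ let $\alpha_i\in\{0,\dots,q-2\}$ with $\alpha_i\equiv\lfloor p^ih/(q+1)\rfloor-p^i\gamma'\pmod{q-1}$, and set $X_i=\mathbf A$ if $\alpha_i<\frac1p\nu+\iota_{i+f}$; $X_i=\mathbf{AB}$ if $\frac1p\nu+\iota_{i+f}\le\alpha_i\le\frac{p-1}{p}\nu-\iota_i$;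 $X_i=\mathbf B$ if $\frac{p-1}p\nu-\iota_i<\alpha_i\le\nu$; $X_i=\mathbf 0$ if $\alpha_i>\nu$; extend $2f$-periodically. Digit sequence: $v_0,\dots,v_{2f-1}\in\{0,\dots,p-1\}$ are defined by $h-(q+1)\gamma'\equiv\sum_{i=0}^{2f-1}v_ip^{2f-1-i}\pmod{q^2-1}$, and $v_i=v_{i\bmod 2f}$. -}

module Defs where

open import Data.Nat as ℕ using (ℕ; zero; suc; _+_; _*_; _∸_; _^_; _<_; _≤_; _<ᵇ_; _≤ᵇ_; _≡ᵇ_)
open import Data.Nat.DivMod as ND using ()
open import Data.Nat.Divisibility using (_∣_)
open import Data.Integer as ℤ using (ℤ; +_)
open import Data.Integer.DivMod as ZD using ()
open import Data.Bool using (Bool; true; false; if_then_else_)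
open import Relation.Binary.PropositionalEquality using (_≡_)
open import Relation.Nullary using (¬_)

-- Total versions of division / remainder (junk value for divisor 0, which
-- never occurs under the hypotheses of the statement).
div' : ℕ → ℕ → ℕ
div' a zero    = 0
div' a (suc n) = a ND./ suc n

mod' : ℕ → ℕ → ℕ
mod' a zero    = a
mod' a (suc n) = a ND.% suc n

modℤ : ℤ → ℕ → ℕ
modℤ z zero    = 0
modℤ z (suc n) = z ZD.%ℕ suc n

sumTo : ℕ → (ℕ → ℕ) → ℕ
sumTo zero    g = 0
sumTo (suc n) g = sumTo n g + g n

data Sym : Set where
  A B AB O : Sym

module _ (p f : ℕ) where

  q : ℕ
  q = p ^ f

  -- Coherent triple (h, γ, γ') ∈ ℤ/(q²-1) × ℤ/(q-1) × ℤ/(q-1), each given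
  -- by its least non-negative representative.
  record Coherent (h γ γ' : ℕ) : Set where
    field
      h<     : h < q ^ 2 ∸ 1
      γ<     : γ < q ∸ 1
      γ'<    : γ' < q ∸ 1
      notDiv : ¬ (q + 1 ∣ h)
      congr  : mod' h (q ∸ 1) ≡ mod' (γ + γ' + div' (q ∸ 1) (p ∸ 1)) (q ∸ 1)

  ν : ℕ
  ν = sumTo f (λ k → if k ≡ᵇ 0 then 0 else p ^ k)

  module _ (h γ' : ℕ) where

    -- r with h ≡ 1 + r (mod q+1), 0 ≤ r ≤ q-1  (h not divisible by q+1)
    r : ℕ
    r = mod' h (q + 1) ∸ 1

    -- h_k for 0 ≤ k ≤ f-1 : base-p digits of r, h_0 most significant
    hd : ℕ → ℕ
    hd k = mod' (div' r (p ^ (f ∸ 1 ∸ k))) p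

    hSeq : ℕ → ℕ
    hSeq i = let k = mod' i (2 * f) in
             if k <ᵇ f then hd k else (p ∸ 1) ∸ hd (k ∸ f)

    ι : ℕ → ℕ
    ι i = if hSeq i ≡ᵇ (p ∸ 1) then 1 else 0

    α : ℕ → ℕ
    α i = modℤ (+ div' (p ^ i * h) (q + 1) ℤ.- + (p ^ i * γ')) (q ∸ 1)

    X₀ : ℕ → Sym
    X₀ i =
      if α i <ᵇ div' ν p + ι (i + f) then A
      else if (div' ν p + ι (i + f) ≤ᵇ α i) ∧ (α i + ι i ≤ᵇ div' ((p ∸ 1) * ν) p) then AB
      else if (div' ((p ∸ 1) * ν) p <ᵇ α i + ι i) ∧ (α i ≤ᵇ ν) then B
      else O
      where open import Data.Bool using (_∧_)

    gene : ℤ → Sym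
    gene i = X₀ (modℤ i (2 * f))

    -- digit sequence: h - (q+1)γ' ≡ Σ_{i=0}^{2f-1} v_i p^{2f-1-i} (mod q²-1)
    N : ℕ
    N = modℤ (+ h ℤ.- + ((q + 1) * γ')) (q ^ 2 ∸ 1)

    vd : ℕ → ℕ
    vd k = mod' (div' N (p ^ (2 * f ∸ 1 ∸ k))) p

    v : ℤ → ℕ
    v i = vd (modℤ i (2 * f))

-- Put Q = q + 1, R = q - 1 and let N be the residue of h - Qγ' modulo q² - 1 = QR = p^(2f) - 1;
-- the v_i are its 2f base-p digits.  With k = i mod 2f, the digit sum in the statement reads
-- these digits cyclically rotated by k, so it is congruent to p^k N modulo QR.  Write
-- p^k h = aQ + b; since Q is coprime to p and does not divide h, 0 < b < Q.  As α_k ≡ a - p^k γ'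
-- modulo R, we get p^k N ≡ Q α_k + b modulo QR, and both sides lie in [0, QR] with the right
-- one positive, so the digit sum is exactly Q α_k + b.  The threshold (q² - 1)/(p - 1) equals
-- Q (ν + 1), hence it is reached iff α_k > ν, which is exactly when X_k = 0 because the
-- lower thresholds ν/p + ι and (p - 1)ν/p of the gene do not exceed ν.
module Submission where

open import Defs
open import Data.Bool using (true; false; if_then_else_; _∧_)
open import Data.Nat
open import Data.Nat.Properties
open import Data.Nat.DivMod hiding (_mod_)
open import Data.Nat.Divisibility using (_∣_; >⇒∤; ∣-trans; ∣m+n∣m⇒∣n; m∣m*n; ∣1⇒≡1; m%n≡0⇒n∣m)
open import Data.Nat.Coprimality using (Coprime; coprime-divisor)
open import Data.Product using (_,_)
open import Data.Sum using (inj₁; inj₂)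
open import Data.Integer using (ℤ; +_)
import Data.Integer as ℤ
import Data.Integer.Properties as ℤ
import Data.Integer.DivMod as ℤ
import Data.Integer.Divisibility.Signed as ℤ
import Data.Integer.Tactic.RingSolver as ℤ-Solver
import Data.Nat.Tactic.RingSolver as ℕ-Solver
open import Relation.Binary.Bundles using (Setoid)
import Relation.Binary.Reasoning.Setoid as SetoidReasoning
open import Relation.Binary.PropositionalEquality
open import Relation.Nullary using (¬_; contradiction; yes; no)
open import Relation.Nullary.Reflects using (ofʸ; ofⁿ; det)
open import Function.Bundles using (_⇔_; mk⇔)
import Function.Properties.Equivalence as ⇔
open import Data.Nat.Primality using (Prime)

div'≡/ : ∀ a n .{{_ : NonZero n}} → div' a n ≡ a / n
div'≡/ a (suc n) = refl

mod'≡% : ∀ a n .{{_ : NonZero n}} → mod' a n ≡ a % n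
mod'≡% a (suc n) = refl

modℤ-spec : ∀ z n .{{_ : NonZero n}} → z ≡ + modℤ z n ℤ.+ (z ℤ./ℕ n) ℤ.* + n
modℤ-spec z (suc n) = ℤ.a≡a%ℕn+[a/ℕn]*n z (suc n)

modℤ<n : ∀ z n .{{_ : NonZero n}} → modℤ z n < n
modℤ<n z (suc n) = ℤ.n%ℕd<d z (suc n)

sumTo-cong : ∀ m {g k : ℕ → ℕ} → (∀ j → j < m → g j ≡ k j) → sumTo m g ≡ sumTo m k
sumTo-cong zero    g≡k = refl
sumTo-cong (suc m) g≡k = cong₂ _+_ (sumTo-cong m (λ j j<m → g≡k j (m<n⇒m<1+n j<m))) (g≡k m ≤-refl)

sumTo-*-distribˡ : ∀ m c (g : ℕ → ℕ) → sumTo m (λ j → c * g j) ≡ c * sumTo m g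
sumTo-*-distribˡ zero    c g = sym (*-zeroʳ c)
sumTo-*-distribˡ (suc m) c g =
  trans (cong (_+ c * g m) (sumTo-*-distribˡ m c g)) (sym (*-distribˡ-+ c (sumTo m g) (g m)))

sumTo-+ : ∀ a b (g : ℕ → ℕ) → sumTo (a + b) g ≡ sumTo a g + sumTo b (λ j → g (a + j))
sumTo-+ a zero    g = trans (cong (λ n → sumTo n g) (+-identityʳ a)) (sym (+-identityʳ _))
sumTo-+ a (suc b) g = begin
  sumTo (a + suc b) g                                ≡⟨ cong (λ n → sumTo n g) (+-suc a b) ⟩
  sumTo (a + b) g + g (a + b)                        ≡⟨ cong (_+ g (a + b)) (sumTo-+ a b g) ⟩
  sumTo a g + sumTo b (λ j → g (a + j)) + g (a + b)  ≡⟨ +-assoc (sumTo a g) _ _ ⟩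
  sumTo a g + sumTo (suc b) (λ j → g (a + j))        ∎
  where open ≡-Reasoning

suc[m∸1∸n]≡m∸n : ∀ {m n} → n < m → suc (m ∸ 1 ∸ n) ≡ m ∸ n
suc[m∸1∸n]≡m∸n {m} {n} n<m = trans (cong suc (∸-+-assoc m 1 n)) (sym (+-∸-assoc 1 n<m))

m+n∸1∸o≡m+[n∸1∸o] : ∀ m {n o} → o < n → m + n ∸ 1 ∸ o ≡ m + (n ∸ 1 ∸ o)
m+n∸1∸o≡m+[n∸1∸o] m {n} {o} o<n = begin
  m + n ∸ 1 ∸ o    ≡⟨ ∸-+-assoc (m + n) 1 o ⟩
  m + n ∸ suc o    ≡⟨ +-∸-assoc m o<n ⟩
  m + (n ∸ suc o)  ≡⟨ cong (_+_ m) (∸-+-assoc n 1 o) ⟨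
  m + (n ∸ 1 ∸ o)  ∎
  where open ≡-Reasoning

[m+n]∸1∸[m+o]≡n∸1∸o : ∀ m n o → m + n ∸ 1 ∸ (m + o) ≡ n ∸ 1 ∸ o
[m+n]∸1∸[m+o]≡n∸1∸o m n o = begin
  m + n ∸ 1 ∸ (m + o)  ≡⟨ ∸-+-assoc (m + n) 1 (m + o) ⟩
  m + n ∸ suc (m + o)  ≡⟨ cong (m + n ∸_) (+-suc m o) ⟨
  m + n ∸ (m + suc o)  ≡⟨ [m+n]∸[m+o]≡n∸o m n (suc o) ⟩
  n ∸ suc o            ≡⟨ ∸-+-assoc n 1 o ⟨
  n ∸ 1 ∸ o            ∎
  where open ≡-Reasoning

module Digits (p : ℕ) .{{_ : NonZero p}} where

  private instance
    p*≢0 : ∀ {P} .{{_ : NonZero P}} → NonZero (p * P)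
    p*≢0 {P} = m*n≢0 p P

  digit : ℕ → ℕ → ℕ
  digit X e = mod' (div' X (p ^ e)) p

  digit-+ : ∀ X a e → digit X (a + e) ≡ digit (div' X (p ^ a)) e
  digit-+ X a e = cong (λ Y → mod' Y p) (begin
    div' X (p ^ (a + e))        ≡⟨ cong (div' X) (^-distribˡ-+-* p a e) ⟩
    div' X (p ^ a * p ^ e)      ≡⟨ div'≡/ X (p ^ a * p ^ e) ⟩
    X / (p ^ a * p ^ e)         ≡⟨ m/n/o≡m/[n*o] X (p ^ a) (p ^ e) ⟨
    X / p ^ a / p ^ e           ≡⟨ /-congˡ {o = p ^ e} (div'≡/ X (p ^ a)) ⟨
    div' X (p ^ a) / p ^ e      ≡⟨ div'≡/ (div' X (p ^ a)) (p ^ e) ⟨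
    div' (div' X (p ^ a)) (p ^ e) ∎)
    where open ≡-Reasoning
          instance _ = m^n≢0 p a
                   _ = m^n≢0 p e
                   _ = m*n≢0 (p ^ a) (p ^ e)

  digit-suc : ∀ X e → digit X (suc e) ≡ digit (X / p) e
  digit-suc X e = trans (digit-+ X 1 e) (cong (λ Y → digit Y e) (trans (div'≡/ X (p * 1)) (/-congʳ (*-identityʳ p))))

  %-*-split : ∀ X P .{{_ : NonZero P}} → X % (p * P) ≡ p * (X / p % P) + X % p
  %-*-split X P = begin
    X % (p * P)                    ≡⟨ %-congʳ (*-comm p P) ⟩
    X % (P * p)                    ≡⟨ cong (_% (P * p)) (trans (m≡m%n+[m/n]*n X p) (+-comm (X % p) _)) ⟩
    (X / p * p + X % p) % (P * p)  ≡⟨ [m*n+o]%[p*n]≡[m*n]%[p*n]+o (X / p) P (m%n<n X p) ⟩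
    X / p * p % (P * p) + X % p    ≡⟨ cong (_+ X % p) (m%n*o≡m*o%[n*o] (X / p) P p) ⟨
    X / p % P * p + X % p          ≡⟨ cong (_+ X % p) (*-comm _ p) ⟩
    p * (X / p % P) + X % p        ∎
    where open ≡-Reasoning
          instance _ = m*n≢0 P p

  digitExpansion : ∀ m X → sumTo m (λ j → p ^ (m ∸ 1 ∸ j) * digit X (m ∸ 1 ∸ j)) ≡ mod' X (p ^ m)
  digitExpansion zero    X = sym (n%1≡0 X)
  digitExpansion (suc m) X = begin
    sumTo m (λ j → p ^ (m ∸ j) * digit X (m ∸ j)) + p ^ (m ∸ m) * digit X (m ∸ m)
      ≡⟨ cong₂ _+_ (sumTo-cong m higher) lowest ⟩
    sumTo m (λ j → p * (p ^ (m ∸ 1 ∸ j) * digit (X / p) (m ∸ 1 ∸ j))) + X % p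
      ≡⟨ cong (_+ X % p) (sumTo-*-distribˡ m p _) ⟩
    p * sumTo m (λ j → p ^ (m ∸ 1 ∸ j) * digit (X / p) (m ∸ 1 ∸ j)) + X % p
      ≡⟨ cong (λ s → p * s + X % p) (trans (digitExpansion m (X / p)) (mod'≡% (X / p) (p ^ m))) ⟩
    p * (X / p % p ^ m) + X % p
      ≡⟨ %-*-split X (p ^ m) ⟨
    X % p ^ suc m
      ≡⟨ mod'≡% X (p ^ suc m) ⟨
    mod' X (p ^ suc m) ∎
    where
    open ≡-Reasoning
    instance _ = m^n≢0 p m
             _ = m^n≢0 p (suc m)
    lowest : p ^ (m ∸ m) * digit X (m ∸ m) ≡ X % p
    lowest rewrite n∸n≡0 m = trans (*-identityˡ _) (trans (mod'≡% _ p) (cong (_% p) (n/1≡n X)))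
    higher : ∀ j → j < m → p ^ (m ∸ j) * digit X (m ∸ j) ≡ p * (p ^ (m ∸ 1 ∸ j) * digit (X / p) (m ∸ 1 ∸ j))
    higher j j<m rewrite sym (suc[m∸1∸n]≡m∸n j<m) =
      trans (cong (p * p ^ (m ∸ 1 ∸ j) *_) (digit-suc X (m ∸ 1 ∸ j))) (*-assoc p _ _)

  -- For X < p^(m+k): the number whose (m+k)-digit expansion is that of X rotated k places left.
  rotation : ℕ → ℕ → ℕ → ℕ
  rotation m k X = p ^ k * mod' X (p ^ m) + div' X (p ^ m)

  div'<p^k : ∀ m k {X} → X < p ^ (m + k) → div' X (p ^ m) < p ^ k
  div'<p^k m k {X} X<p^[m+k] = subst (_< p ^ k) (sym (div'≡/ X (p ^ m)))
    (m<n*o⇒m/o<n (subst (X <_) (trans (^-distribˡ-+-* p m k) (*-comm (p ^ m) (p ^ k))) X<p^[m+k]))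
    where instance _ = m^n≢0 p m

  rotation<p^[m+k] : ∀ m k {X} → X < p ^ (m + k) → rotation m k X < p ^ (m + k)
  rotation<p^[m+k] m k {X} X<p^[m+k] = begin-strict
    p ^ k * mod' X (p ^ m) + div' X (p ^ m) <⟨ +-monoʳ-< (p ^ k * mod' X (p ^ m)) (div'<p^k m k X<p^[m+k]) ⟩
    p ^ k * mod' X (p ^ m) + p ^ k          ≡⟨ +-comm _ (p ^ k) ⟩
    p ^ k + p ^ k * mod' X (p ^ m)          ≡⟨ *-suc (p ^ k) _ ⟨
    p ^ k * suc (mod' X (p ^ m))            ≤⟨ *-monoʳ-≤ (p ^ k) mod'<p^m ⟩
    p ^ k * p ^ m                           ≡⟨ trans (^-distribˡ-+-* p m k) (*-comm (p ^ m) (p ^ k)) ⟨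
    p ^ (m + k)                             ∎
    where open ≤-Reasoning
          instance _ = m^n≢0 p m
          mod'<p^m : mod' X (p ^ m) < p ^ m
          mod'<p^m = subst (_< p ^ m) (sym (mod'≡% X (p ^ m))) (m%n<n X (p ^ m))

  -- Rotating the expansion multiplies by p^k modulo p^(m+k) - 1, written without subtraction.
  p^k*X≡rotation : ∀ m k X → p ^ k * X + div' X (p ^ m) ≡ rotation m k X + div' X (p ^ m) * p ^ (m + k)
  p^k*X≡rotation m k X = begin
    p ^ k * X + H                           ≡⟨ cong (λ Y → p ^ k * Y + H) X≡L+H*p^m ⟩
    p ^ k * (L + H * p ^ m) + H             ≡⟨ shuffle (p ^ k) L H (p ^ m) ⟩
    p ^ k * L + H + H * (p ^ m * p ^ k)     ≡⟨ cong (λ e → p ^ k * L + H + H * e) (^-distribˡ-+-* p m k) ⟨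
    p ^ k * L + H + H * p ^ (m + k)         ∎
    where open ≡-Reasoning
          instance _ = m^n≢0 p m
          L H : ℕ
          L = mod' X (p ^ m)
          H = div' X (p ^ m)
          X≡L+H*p^m : X ≡ L + H * p ^ m
          X≡L+H*p^m = trans (m≡m%n+[m/n]*n X (p ^ m)) (sym (cong₂ (λ l h → l + h * p ^ m) (mod'≡% X (p ^ m)) (div'≡/ X (p ^ m))))
          shuffle : ∀ P L H M → P * (L + H * M) + H ≡ P * L + H + H * (M * P)
          shuffle = ℕ-Solver.solve-∀

  rotatedDigitExpansion-+ : ∀ m k X (φ : ℕ → ℕ) → X < p ^ (m + k) →
    (∀ j → j < m → φ j ≡ k + j) → (∀ j → j < k → φ (m + j) ≡ j) →
    sumTo (m + k) (λ j → p ^ (m + k ∸ 1 ∸ j) * digit X (m + k ∸ 1 ∸ φ j)) ≡ rotation m k X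
  rotatedDigitExpansion-+ m k X φ X<p^[m+k] φ-low φ-high = begin
    sumTo (m + k) term
      ≡⟨ sumTo-+ m k term ⟩
    sumTo m term + sumTo k (λ j → term (m + j))
      ≡⟨ cong₂ _+_ (sumTo-cong m low) (sumTo-cong k high) ⟩
    sumTo m (λ j → p ^ k * (p ^ (m ∸ 1 ∸ j) * digit X (m ∸ 1 ∸ j)))
      + sumTo k (λ j → p ^ (k ∸ 1 ∸ j) * digit H (k ∸ 1 ∸ j))
      ≡⟨ cong₂ _+_ (sumTo-*-distribˡ m (p ^ k) _) (digitExpansion k H) ⟩
    p ^ k * sumTo m (λ j → p ^ (m ∸ 1 ∸ j) * digit X (m ∸ 1 ∸ j)) + mod' H (p ^ k)
      ≡⟨ cong₂ (λ L H′ → p ^ k * L + H′) (digitExpansion m X) (trans (mod'≡% H (p ^ k)) (m<n⇒m%n≡m (div'<p^k m k X<p^[m+k]))) ⟩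
    p ^ k * mod' X (p ^ m) + H ∎
    where
    open ≡-Reasoning
    instance _ = m^n≢0 p m
             _ = m^n≢0 p k
    term : ℕ → ℕ
    term j = p ^ (m + k ∸ 1 ∸ j) * digit X (m + k ∸ 1 ∸ φ j)
    H : ℕ
    H = div' X (p ^ m)
    low : ∀ j → j < m → term j ≡ p ^ k * (p ^ (m ∸ 1 ∸ j) * digit X (m ∸ 1 ∸ j))
    low j j<m = begin
      p ^ (m + k ∸ 1 ∸ j) * digit X (m + k ∸ 1 ∸ φ j)
        ≡⟨ cong₂ (λ n i → p ^ (n ∸ 1 ∸ j) * digit X (n ∸ 1 ∸ i)) (+-comm m k) (φ-low j j<m) ⟩
      p ^ (k + m ∸ 1 ∸ j) * digit X (k + m ∸ 1 ∸ (k + j))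
        ≡⟨ cong₂ (λ e i → p ^ e * digit X i) (m+n∸1∸o≡m+[n∸1∸o] k j<m) ([m+n]∸1∸[m+o]≡n∸1∸o k m j) ⟩
      p ^ (k + (m ∸ 1 ∸ j)) * digit X (m ∸ 1 ∸ j)
        ≡⟨ cong (_* digit X (m ∸ 1 ∸ j)) (^-distribˡ-+-* p k _) ⟩
      p ^ k * p ^ (m ∸ 1 ∸ j) * digit X (m ∸ 1 ∸ j)
        ≡⟨ *-assoc (p ^ k) _ _ ⟩
      p ^ k * (p ^ (m ∸ 1 ∸ j) * digit X (m ∸ 1 ∸ j)) ∎
    high : ∀ j → j < k → term (m + j) ≡ p ^ (k ∸ 1 ∸ j) * digit H (k ∸ 1 ∸ j)
    high j j<k = begin
      p ^ (m + k ∸ 1 ∸ (m + j)) * digit X (m + k ∸ 1 ∸ φ (m + j))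
        ≡⟨ cong₂ (λ e i → p ^ e * digit X (m + k ∸ 1 ∸ i)) ([m+n]∸1∸[m+o]≡n∸1∸o m k j) (φ-high j j<k) ⟩
      p ^ (k ∸ 1 ∸ j) * digit X (m + k ∸ 1 ∸ j)
        ≡⟨ cong (λ i → p ^ (k ∸ 1 ∸ j) * digit X i) (m+n∸1∸o≡m+[n∸1∸o] m j<k) ⟩
      p ^ (k ∸ 1 ∸ j) * digit X (m + (k ∸ 1 ∸ j))
        ≡⟨ cong (p ^ (k ∸ 1 ∸ j) *_) (digit-+ X m (k ∸ 1 ∸ j)) ⟩
      p ^ (k ∸ 1 ∸ j) * digit H (k ∸ 1 ∸ j) ∎

  rotatedDigitExpansion : ∀ n k X (φ : ℕ → ℕ) → k ≤ n → X < p ^ n →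
    (∀ j → j < n ∸ k → φ j ≡ k + j) → (∀ j → j < k → φ (n ∸ k + j) ≡ j) →
    sumTo n (λ j → p ^ (n ∸ 1 ∸ j) * digit X (n ∸ 1 ∸ φ j)) ≡ rotation (n ∸ k) k X
  rotatedDigitExpansion n k X φ k≤n = go (n ∸ k) (m∸n+n≡m k≤n)
    where go : ∀ m → m + k ≡ n → X < p ^ n → (∀ j → j < m → φ j ≡ k + j) → (∀ j → j < k → φ (m + j) ≡ j) →
               sumTo n (λ j → p ^ (n ∸ 1 ∸ j) * digit X (n ∸ 1 ∸ φ j)) ≡ rotation m k X
          go m refl = rotatedDigitExpansion-+ m k X φ

infix 4 _≡_mod_

-- A record rather than a synonym for n ∣ x - y, so that x and y can be inferred.
record _≡_mod_ (x y : ℤ) (n : ℕ) : Set where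
  constructor ∣-difference
  field modulus∣difference : + n ℤ.∣ x ℤ.- y

module _ {n : ℕ} where

  ≡-mod-refl : ∀ {x} → x ≡ x mod n
  ≡-mod-refl {x} = ∣-difference (ℤ.divides (+ 0) (trans (ℤ.+-inverseʳ x) (sym (ℤ.*-zeroˡ (+ n)))))

  ≡-mod-sym : ∀ {x y} → x ≡ y mod n → y ≡ x mod n
  ≡-mod-sym {x} {y} (∣-difference n∣x-y) = ∣-difference (subst (+ n ℤ.∣_) (negate x y) (ℤ.∣m⇒∣-m n∣x-y))
    where negate : ∀ x y → ℤ.- (x ℤ.- y) ≡ y ℤ.- x
          negate = ℤ-Solver.solve-∀

  ≡-mod-trans : ∀ {x y z} → x ≡ y mod n → y ≡ z mod n → x ≡ z mod n
  ≡-mod-trans {x} {y} {z} (∣-difference n∣x-y) (∣-difference n∣y-z) =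
    ∣-difference (subst (+ n ℤ.∣_) (telescope x y z) (ℤ.∣m∣n⇒∣m+n n∣x-y n∣y-z))
    where telescope : ∀ x y z → (x ℤ.- y) ℤ.+ (y ℤ.- z) ≡ x ℤ.- z
          telescope = ℤ-Solver.solve-∀

  ≡-mod-setoid : Setoid _ _
  ≡-mod-setoid = record
    { Carrier       = ℤ
    ; _≈_           = λ x y → x ≡ y mod n
    ; isEquivalence = record { refl = ≡-mod-refl ; sym = ≡-mod-sym ; trans = ≡-mod-trans }
    }

  ≡-mod-+ʳ : ∀ {x y} z → x ≡ y mod n → x ℤ.+ z ≡ y ℤ.+ z mod n
  ≡-mod-+ʳ {x} {y} z (∣-difference n∣x-y) = ∣-difference (subst (+ n ℤ.∣_) (cancel x y z) n∣x-y)
    where cancel : ∀ x y z → x ℤ.- y ≡ (x ℤ.+ z) ℤ.- (y ℤ.+ z)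
          cancel = ℤ-Solver.solve-∀

  ≡-mod-*ˡ : ∀ {x y} c → x ≡ y mod n → c ℤ.* x ≡ c ℤ.* y mod n
  ≡-mod-*ˡ {x} {y} c (∣-difference n∣x-y) = ∣-difference (subst (+ n ℤ.∣_) (distrib c x y) (ℤ.∣n⇒∣m*n c n∣x-y))
    where distrib : ∀ c x y → c ℤ.* (x ℤ.- y) ≡ c ℤ.* x ℤ.- c ℤ.* y
          distrib = ℤ-Solver.solve-∀

  ≡-mod-*-scale : ∀ {x y} c → x ≡ y mod n → + c ℤ.* x ≡ + c ℤ.* y mod (c * n)
  ≡-mod-*-scale {x} {y} c (∣-difference n∣x-y) =
    ∣-difference (subst₂ ℤ._∣_ (sym (ℤ.pos-* c n)) (distrib (+ c) x y) (ℤ.*-monoʳ-∣ (+ c) n∣x-y))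
    where distrib : ∀ c x y → c ℤ.* (x ℤ.- y) ≡ c ℤ.* x ℤ.- c ℤ.* y
          distrib = ℤ-Solver.solve-∀

  +-multiple-≡-mod : ∀ x t → + (x + t * n) ≡ + x mod n
  +-multiple-≡-mod x t = ∣-difference (ℤ.divides (+ t) (begin
    + (x + t * n) ℤ.- + x        ≡⟨ cong (ℤ._- + x) (trans (ℤ.pos-+ x (t * n)) (cong (ℤ._+_ (+ x)) (ℤ.pos-* t n))) ⟩
    + x ℤ.+ + t ℤ.* + n ℤ.- + x  ≡⟨ cancel (+ x) (+ t ℤ.* + n) ⟩
    + t ℤ.* + n                  ∎))
    where open ≡-Reasoning
          cancel : ∀ x y → x ℤ.+ y ℤ.- x ≡ y
          cancel = ℤ-Solver.solve-∀

  %-≡-mod : ∀ m .{{_ : NonZero n}} → + (m % n) ≡ + m mod n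
  %-≡-mod m = subst (λ k → + (m % n) ≡ + k mod n) (sym (m≡m%n+[m/n]*n m n))
                    (≡-mod-sym (+-multiple-≡-mod (m % n) (m / n)))

  modℤ-≡-mod : ∀ z .{{_ : NonZero n}} → + modℤ z n ≡ z mod n
  modℤ-≡-mod z = ∣-difference (ℤ.divides (ℤ.- (z ℤ./ℕ n)) (begin
    + modℤ z n ℤ.- z                               ≡⟨ cong (ℤ._-_ (+ modℤ z n)) (modℤ-spec z n) ⟩
    + modℤ z n ℤ.- (+ modℤ z n ℤ.+ z ℤ./ℕ n ℤ.* + n) ≡⟨ cancel (+ modℤ z n) (z ℤ./ℕ n) (+ n) ⟩
    ℤ.- (z ℤ./ℕ n) ℤ.* + n                         ∎))
    where open ≡-Reasoning
          cancel : ∀ r t n → r ℤ.- (r ℤ.+ t ℤ.* n) ≡ ℤ.- t ℤ.* n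
          cancel = ℤ-Solver.solve-∀

  ≡-mod⇒≡ : ∀ {x y} → x < n → y < n → + x ≡ + y mod n → x ≡ y
  ≡-mod⇒≡ {x} {y} x<n y<n (∣-difference n∣x-y) =
    ℤ.+-injective (ℤ.i-j≡0⇒i≡j (+ x) (+ y) (ℤ.∣i∣≡0⇒i≡0 (small-multiple≡0 distance<n (ℤ.∣⇒∣ᵤ n∣x-y))))
    where
    distance<n : ℤ.∣ + x ℤ.- + y ∣ < n
    distance<n = subst (_< n) (cong ℤ.∣_∣ (sym (ℤ.[+m]-[+n]≡m⊖n x y)))
                   (≤-<-trans (ℤ.∣m⊝n∣≤m⊔n x y) (⊔-lub x<n y<n))
    small-multiple≡0 : ∀ {d} → d < n → n ∣ d → d ≡ 0
    small-multiple≡0 {zero}  _   _   = refl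
    small-multiple≡0 {suc d} d<n n∣d = contradiction n∣d (>⇒∤ d<n)

  ≡-mod⇒≡-≤ : ∀ {x y} → x ≤ n → 0 < y → y < n → + x ≡ + y mod n → x ≡ y
  ≡-mod⇒≡-≤ {x} {y} x≤n 0<y y<n x≡y with m≤n⇒m<n∨m≡n x≤n
  ... | inj₁ x<n  = ≡-mod⇒≡ x<n y<n x≡y
  ... | inj₂ refl = contradiction (≡-mod⇒≡ (≤-<-trans z≤n y<n) y<n 0≡y) (<⇒≢ 0<y)
    where 0≡y : + 0 ≡ + y mod n
          0≡y = ≡-mod-trans (subst (λ m → + 0 ≡ + m mod n) (+-identityʳ n) (≡-mod-sym (+-multiple-≡-mod 0 1))) x≡y

modℤ-+ : ∀ i j n .{{_ : NonZero n}} → modℤ (i ℤ.+ + j) n ≡ (modℤ i n + j) % n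
modℤ-+ i j n = ≡-mod⇒≡ (modℤ<n _ n) (m%n<n _ n) (begin
  + modℤ (i ℤ.+ + j) n        ≈⟨ modℤ-≡-mod _ ⟩
  i ℤ.+ + j                  ≈⟨ ≡-mod-+ʳ (+ j) (modℤ-≡-mod i) ⟨
  + modℤ i n ℤ.+ + j         ≡⟨ ℤ.pos-+ (modℤ i n) j ⟨
  + (modℤ i n + j)           ≈⟨ %-≡-mod _ ⟨
  + ((modℤ i n + j) % n)     ∎)
  where open SetoidReasoning (≡-mod-setoid {n})

<ᵇ-true : ∀ {m n} → m < n → (m <ᵇ n) ≡ true
<ᵇ-true {m} {n} m<n = det (<ᵇ-reflects-< m n) (ofʸ m<n)

<ᵇ-false : ∀ {m n} → ¬ m < n → (m <ᵇ n) ≡ false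
<ᵇ-false {m} {n} m≮n = det (<ᵇ-reflects-< m n) (ofⁿ m≮n)

≤ᵇ-true : ∀ {m n} → m ≤ n → (m ≤ᵇ n) ≡ true
≤ᵇ-true {m} {n} m≤n = det (≤ᵇ-reflects-≤ m n) (ofʸ m≤n)

≤ᵇ-false : ∀ {m n} → ¬ m ≤ n → (m ≤ᵇ n) ≡ false
≤ᵇ-false {m} {n} m≰n = det (≤ᵇ-reflects-≤ m n) (ofⁿ m≰n)

-- X₀ i unfolds to geneSymbol (α i) ν (ν / p) ((p - 1) ν / p) (ι i) (ι (i + f)).
geneSymbol : (α ν lower upper ι ι′ : ℕ) → Sym
geneSymbol α ν lower upper ι ι′ =
  if α <ᵇ lower + ι′ then A
  else if (lower + ι′ ≤ᵇ α) ∧ (α + ι ≤ᵇ upper) then AB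
  else if (upper <ᵇ α + ι) ∧ (α ≤ᵇ ν) then B
  else O

module _ {α ν lower upper ι ι′ : ℕ} where

  geneSymbol≢O : α ≤ ν → geneSymbol α ν lower upper ι ι′ ≢ O
  geneSymbol≢O α≤ν with α <? lower + ι′ | α + ι ≤? upper
  ... | yes α<lower | _ rewrite <ᵇ-true α<lower = λ ()
  ... | no α≮lower | yes α+ι≤upper
    rewrite <ᵇ-false α≮lower | ≤ᵇ-true (≮⇒≥ α≮lower) | ≤ᵇ-true α+ι≤upper = λ ()
  ... | no α≮lower | no α+ι≰upper
    rewrite <ᵇ-false α≮lower | ≤ᵇ-true (≮⇒≥ α≮lower) | ≤ᵇ-false α+ι≰upper
          | <ᵇ-true (≰⇒> α+ι≰upper) | ≤ᵇ-true α≤ν = λ ()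

  geneSymbol≡O⇔ν<α : lower + ι′ ≤ ν → upper ≤ ν → geneSymbol α ν lower upper ι ι′ ≡ O ⇔ ν < α
  geneSymbol≡O⇔ν<α lower≤ν upper≤ν = mk⇔ to from
    where
    to : geneSymbol α ν lower upper ι ι′ ≡ O → ν < α
    to symbol≡O with ν <? α
    ... | yes ν<α = ν<α
    ... | no ν≮α = contradiction symbol≡O (geneSymbol≢O (≮⇒≥ ν≮α))
    from : ν < α → geneSymbol α ν lower upper ι ι′ ≡ O
    from ν<α rewrite <ᵇ-false (≤⇒≯ (≤-trans lower≤ν (<⇒≤ ν<α)))
                   | ≤ᵇ-true (≤-trans lower≤ν (<⇒≤ ν<α))
                   | ≤ᵇ-false (<⇒≱ (<-≤-trans (≤-<-trans upper≤ν ν<α) (m≤m+n α ι)))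
                   | <ᵇ-true (<-≤-trans (≤-<-trans upper≤ν ν<α) (m≤m+n α ι))
                   | ≤ᵇ-false (<⇒≱ ν<α) = refl

suc[ν]≡Σp^ : ∀ p m → suc (ν p (suc m)) ≡ sumTo (suc m) (p ^_)
suc[ν]≡Σp^ p zero    = refl
suc[ν]≡Σp^ p (suc m) = cong (_+ p ^ suc m) (suc[ν]≡Σp^ p m)

geometricSum : ∀ c m → c * sumTo m (suc c ^_) + 1 ≡ suc c ^ m
geometricSum c zero    = cong (_+ 1) (*-zeroʳ c)
geometricSum c (suc m) = begin
  c * (G + P) + 1   ≡⟨ shuffle c G P ⟩
  c * G + 1 + c * P ≡⟨ cong (_+ c * P) (geometricSum c m) ⟩
  P + c * P         ∎
  where open ≡-Reasoning
        G P : ℕ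
        G = sumTo m (suc c ^_)
        P = suc c ^ m
        shuffle : ∀ c x y → c * (x + y) + 1 ≡ c * x + 1 + c * y
        shuffle = ℕ-Solver.solve-∀

q∸1≡[p∸1]*suc[ν] : ∀ c m → q (suc c) (suc m) ∸ 1 ≡ c * suc (ν (suc c) (suc m))
q∸1≡[p∸1]*suc[ν] c m = begin
  q (suc c) (suc m) ∸ 1                           ≡⟨ cong (_∸ 1) (geometricSum c (suc m)) ⟨
  c * sumTo (suc m) (suc c ^_) + 1 ∸ 1            ≡⟨ m+n∸n≡m _ 1 ⟩
  c * sumTo (suc m) (suc c ^_)                    ≡⟨ cong (c *_) (suc[ν]≡Σp^ (suc c) m) ⟨
  c * suc (ν (suc c) (suc m))                     ∎
  where open ≡-Reasoning

[m+1]*[m∸1]+1≡m^2 : ∀ m .{{_ : NonZero m}} → (m + 1) * (m ∸ 1) + 1 ≡ m ^ 2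
[m+1]*[m∸1]+1≡m^2 (suc m) = square m
  where square : ∀ m → (1 + m + 1) * m + 1 ≡ (1 + m) * ((1 + m) * 1)
        square = ℕ-Solver.solve-∀

m^2∸1≡[m+1]*[m∸1] : ∀ m .{{_ : NonZero m}} → m ^ 2 ∸ 1 ≡ (m + 1) * (m ∸ 1)
m^2∸1≡[m+1]*[m∸1] m = trans (cong (_∸ 1) (sym ([m+1]*[m∸1]+1≡m^2 m))) (m+n∸n≡m _ 1)

threshold≡[q+1]*suc[ν] : ∀ c m .{{_ : NonZero c}} →
  div' (q (suc c) (suc m) ^ 2 ∸ 1) c ≡ (q (suc c) (suc m) + 1) * suc (ν (suc c) (suc m))
threshold≡[q+1]*suc[ν] c m = begin
  div' (q′ ^ 2 ∸ 1) c          ≡⟨ div'≡/ _ c ⟩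
  (q′ ^ 2 ∸ 1) / c             ≡⟨ /-congˡ (m^2∸1≡[m+1]*[m∸1] q′) ⟩
  (q′ + 1) * (q′ ∸ 1) / c      ≡⟨ /-congˡ (cong ((q′ + 1) *_) (q∸1≡[p∸1]*suc[ν] c m)) ⟩
  (q′ + 1) * (c * V) / c       ≡⟨ /-congˡ (shuffle (q′ + 1) c V) ⟩
  (q′ + 1) * V * c / c         ≡⟨ m*n/n≡m _ c ⟩
  (q′ + 1) * V                 ∎
  where open ≡-Reasoning
        q′ V : ℕ
        q′ = q (suc c) (suc m)
        V = suc (ν (suc c) (suc m))
        instance _ = m^n≢0 (suc c) (suc m)
        shuffle : ∀ a c v → a * (c * v) ≡ a * v * c
        shuffle = ℕ-Solver.solve-∀

ν/p<ν : ∀ p m .{{_ : NonZero p}} → 1 < p → div' (ν p (suc (suc m))) p < ν p (suc (suc m))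
ν/p<ν p m 1<p = subst (_< V) (sym (div'≡/ V p)) (m/n<m V p {{>-nonZero 0<V}} 1<p)
  where V : ℕ
        V = ν p (suc (suc m))
        0<V : 0 < V
        0<V = ≤-trans (m^n>0 p (suc m)) (m≤n+m _ (ν p (suc m)))

[p∸1]*m/p≤m : ∀ p m .{{_ : NonZero p}} → div' ((p ∸ 1) * m) p ≤ m
[p∸1]*m/p≤m p m = begin
  div' ((p ∸ 1) * m) p ≡⟨ div'≡/ _ p ⟩
  (p ∸ 1) * m / p      ≤⟨ /-monoˡ-≤ p (*-monoˡ-≤ m (m∸n≤m p 1)) ⟩
  p * m / p            ≡⟨ /-congˡ (*-comm p m) ⟩
  m * p / p            ≡⟨ m*n/n≡m m p ⟩
  m                    ∎
  where open ≤-Reasoning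

m<n⇔o*suc[m]≤o*n+r : ∀ {m n o r} → r < o → m < n ⇔ o * suc m ≤ o * n + r
m<n⇔o*suc[m]≤o*n+r {m} {n} {o} {r} r<o = mk⇔ to from
  where
  to : m < n → o * suc m ≤ o * n + r
  to m<n = ≤-trans (*-monoʳ-≤ o m<n) (m≤m+n (o * n) r)
  from : o * suc m ≤ o * n + r → m < n
  from o*suc[m]≤ = s≤s⁻¹ (*-cancelˡ-< o (suc m) (suc n) (begin-strict
    o * suc m   ≤⟨ o*suc[m]≤ ⟩
    o * n + r   <⟨ +-monoʳ-< (o * n) r<o ⟩
    o * n + o   ≡⟨ +-comm (o * n) o ⟩
    o + o * n   ≡⟨ *-suc o n ⟨
    o * suc n   ∎))
    where open ≤-Reasoning

p^suc[m]+1-coprime-p : ∀ p m → Coprime (p ^ suc m + 1) p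
p^suc[m]+1-coprime-p p m (d∣p^suc[m]+1 , d∣p) = ∣1⇒≡1 (∣m+n∣m⇒∣n d∣p^suc[m]+1 (∣-trans d∣p (m∣m*n (p ^ m))))

coprime-∤-p^k* : ∀ {Q p h} → Coprime Q p → ¬ Q ∣ h → ∀ k → ¬ Q ∣ p ^ k * h
coprime-∤-p^k* {Q} {p} {h} Q⊥p Q∤h zero    Q∣h′ = Q∤h (subst (Q ∣_) (+-identityʳ h) Q∣h′)
coprime-∤-p^k* {Q} {p} {h} Q⊥p Q∤h (suc k) Q∣h′ =
  coprime-∤-p^k* Q⊥p Q∤h k (coprime-divisor Q⊥p (subst (Q ∣_) (*-assoc p (p ^ k) h) Q∣h′))

module CyclicDigitSum (c f₀ h γ′ : ℕ) .{{_ : NonZero c}} where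

  p f n Q R : ℕ
  p = suc c
  f = suc f₀
  n = 2 * f
  Q = q p f + 1
  R = q p f ∸ 1

  open Digits p

  q²∸1≡QR : q p f ^ 2 ∸ 1 ≡ Q * R
  q²∸1≡QR = m^2∸1≡[m+1]*[m∸1] (q p f) {{m^n≢0 p f}}

  instance
    Q≢0 : NonZero Q
    Q≢0 = subst NonZero (+-comm 1 (q p f)) _
    R≢0 : NonZero R
    R≢0 = subst NonZero (sym (q∸1≡[p∸1]*suc[ν] c f₀)) (m*n≢0 c _)
    q²∸1≢0 : NonZero (q p f ^ 2 ∸ 1)
    q²∸1≢0 = subst NonZero (sym q²∸1≡QR) (m*n≢0 Q R)

  q²≡p^n : q p f ^ 2 ≡ p ^ n
  q²≡p^n = trans (^-*-assoc p f 2) (cong (p ^_) (*-comm f 2))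

  p^n≡QR+1 : p ^ n ≡ Q * R + 1
  p^n≡QR+1 = trans (sym q²≡p^n) (sym ([m+1]*[m∸1]+1≡m^2 (q p f) {{m^n≢0 p f}}))

  digitSum : ℤ → ℕ
  digitSum i = sumTo n (λ j → p ^ (n ∸ 1 ∸ j) * v p f h γ′ (i ℤ.+ + j))

  module _ (i : ℤ) where

    k : ℕ
    k = modℤ i n

    k≤n : k ≤ n
    k≤n = <⇒≤ (modℤ<n i n)

    φ : ℕ → ℕ
    φ j = (k + j) % n

    φ-low : ∀ j → j < n ∸ k → φ j ≡ k + j
    φ-low j j<n∸k = m<n⇒m%n≡m (subst (k + j <_) (m+[n∸m]≡n k≤n) (+-monoʳ-< k j<n∸k))

    φ-high : ∀ j → j < k → φ (n ∸ k + j) ≡ j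
    φ-high j j<k = begin
      (k + (n ∸ k + j)) % n  ≡⟨ cong (_% n) (trans (sym (+-assoc k (n ∸ k) j)) (cong (_+ j) (m+[n∸m]≡n k≤n))) ⟩
      (n + j) % n            ≡⟨ trans (cong (_% n) (+-comm n j)) ([m+n]%n≡m%n j n) ⟩
      j % n                  ≡⟨ m<n⇒m%n≡m (<-≤-trans j<k k≤n) ⟩
      j                      ∎
      where open ≡-Reasoning

    Nhγ′ : ℕ
    Nhγ′ = N p f h γ′

    Nhγ′<p^n : Nhγ′ < p ^ n
    Nhγ′<p^n = <-≤-trans (modℤ<n _ (q p f ^ 2 ∸ 1)) (≤-trans (m∸n≤m _ 1) (≤-reflexive q²≡p^n))

    digitSum≡rotation : digitSum i ≡ rotation (n ∸ k) k Nhγ′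
    digitSum≡rotation = trans
      (sumTo-cong n (λ j _ → cong (λ t → p ^ (n ∸ 1 ∸ j) * digit Nhγ′ (n ∸ 1 ∸ t)) (modℤ-+ i j n)))
      (rotatedDigitExpansion n k Nhγ′ φ k≤n Nhγ′<p^n φ-low φ-high)

    P a b αₖ H S : ℕ
    P = p ^ k
    a = div' (P * h) Q
    b = mod' (P * h) Q
    αₖ = α p f h γ′ k
    H = div' Nhγ′ (p ^ (n ∸ k))
    S = rotation (n ∸ k) k Nhγ′

    P*h≡b+a*Q : P * h ≡ b + a * Q
    P*h≡b+a*Q = trans (m≡m%n+[m/n]*n (P * h) Q)
                      (sym (cong₂ (λ r d → r + d * Q) (mod'≡% (P * h) Q) (div'≡/ (P * h) Q)))

    P*Nhγ′≡S+H*QR : P * Nhγ′ ≡ S + H * (Q * R)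
    P*Nhγ′≡S+H*QR = +-cancelʳ-≡ H _ _ (begin
      P * Nhγ′ + H             ≡⟨ p^k*X≡rotation (n ∸ k) k Nhγ′ ⟩
      S + H * p ^ (n ∸ k + k)  ≡⟨ cong (λ e → S + H * p ^ e) (m∸n+n≡m k≤n) ⟩
      S + H * p ^ n            ≡⟨ cong (λ x → S + H * x) p^n≡QR+1 ⟩
      S + H * (Q * R + 1)      ≡⟨ shuffle S H (Q * R) ⟩
      S + H * (Q * R) + H      ∎)
      where open ≡-Reasoning
            shuffle : ∀ s h d → s + h * (d + 1) ≡ s + h * d + h
            shuffle = ℕ-Solver.solve-∀

    S≡Qαₖ+b-mod-QR : + S ≡ + (Q * αₖ + b) mod (Q * R)
    S≡Qαₖ+b-mod-QR = begin
      + S                                    ≈⟨ +-multiple-≡-mod S H ⟨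
      + (S + H * (Q * R))                    ≡⟨ cong +_ P*Nhγ′≡S+H*QR ⟨
      + (P * Nhγ′)                           ≡⟨ ℤ.pos-* P Nhγ′ ⟩
      + P ℤ.* + Nhγ′                         ≈⟨ ≡-mod-*ˡ (+ P) Nhγ′≡h-Qγ′ ⟩
      + P ℤ.* (+ h ℤ.- + (Q * γ′))           ≡⟨ expand ⟩
      + (P * h) ℤ.- + Q ℤ.* + (P * γ′)       ≡⟨ cong (λ x → + x ℤ.- + Q ℤ.* + (P * γ′)) P*h≡b+a*Q ⟩
      + (b + a * Q) ℤ.- + Q ℤ.* + (P * γ′)   ≡⟨ regroup ⟩
      + Q ℤ.* (+ a ℤ.- + (P * γ′)) ℤ.+ + b   ≈⟨ ≡-mod-+ʳ (+ b) (≡-mod-*-scale Q (modℤ-≡-mod _)) ⟨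
      + Q ℤ.* + αₖ ℤ.+ + b                   ≡⟨ trans (ℤ.pos-+ (Q * αₖ) b) (cong (ℤ._+ + b) (ℤ.pos-* Q αₖ)) ⟨
      + (Q * αₖ + b)                         ∎
      where
      open SetoidReasoning (≡-mod-setoid {Q * R})
      Nhγ′≡h-Qγ′ : + Nhγ′ ≡ + h ℤ.- + (Q * γ′) mod (Q * R)
      Nhγ′≡h-Qγ′ = subst (λ d → + Nhγ′ ≡ + h ℤ.- + (Q * γ′) mod d) q²∸1≡QR (modℤ-≡-mod _)
      expand : + P ℤ.* (+ h ℤ.- + (Q * γ′)) ≡ + (P * h) ℤ.- + Q ℤ.* + (P * γ′)
      expand = trans (cong (λ x → + P ℤ.* (+ h ℤ.- x)) (ℤ.pos-* Q γ′))
                     (trans (ring (+ P) (+ h) (+ Q) (+ γ′))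
                            (sym (cong₂ (λ x y → x ℤ.- + Q ℤ.* y) (ℤ.pos-* P h) (ℤ.pos-* P γ′))))
        where ring : ∀ P h Q g → P ℤ.* (h ℤ.- Q ℤ.* g) ≡ P ℤ.* h ℤ.- Q ℤ.* (P ℤ.* g)
              ring = ℤ-Solver.solve-∀
      regroup : + (b + a * Q) ℤ.- + Q ℤ.* + (P * γ′) ≡ + Q ℤ.* (+ a ℤ.- + (P * γ′)) ℤ.+ + b
      regroup = trans (cong (ℤ._- + Q ℤ.* + (P * γ′)) (trans (ℤ.pos-+ b (a * Q)) (cong (ℤ._+_ (+ b)) (ℤ.pos-* a Q))))
                      (ring (+ b) (+ a) (+ Q) (+ (P * γ′)))
        where ring : ∀ b a Q g → b ℤ.+ a ℤ.* Q ℤ.- Q ℤ.* g ≡ Q ℤ.* (a ℤ.- g) ℤ.+ b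
              ring = ℤ-Solver.solve-∀

    -- S = QR is not excluded here; it is ruled out later by 0 < b.
    S≤QR : S ≤ Q * R
    S≤QR = s≤s⁻¹ (begin-strict
      S                       <⟨ rotation<p^[m+k] (n ∸ k) k (subst (λ e → Nhγ′ < p ^ e) (sym n∸k+k≡n) Nhγ′<p^n) ⟩
      p ^ (n ∸ k + k)         ≡⟨ cong (p ^_) n∸k+k≡n ⟩
      p ^ n                   ≡⟨ trans p^n≡QR+1 (+-comm (Q * R) 1) ⟩
      suc (Q * R)             ∎)
      where open ≤-Reasoning
            n∸k+k≡n : n ∸ k + k ≡ n
            n∸k+k≡n = m∸n+n≡m k≤n

    b<Q : b < Q
    b<Q = subst (_< Q) (sym (mod'≡% (P * h) Q)) (m%n<n (P * h) Q)

    Qαₖ+b<QR : Q * αₖ + b < Q * R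
    Qαₖ+b<QR = begin-strict
      Q * αₖ + b  <⟨ +-monoʳ-< (Q * αₖ) b<Q ⟩
      Q * αₖ + Q  ≡⟨ trans (+-comm (Q * αₖ) Q) (sym (*-suc Q αₖ)) ⟩
      Q * suc αₖ  ≤⟨ *-monoʳ-≤ Q (modℤ<n _ R) ⟩
      Q * R       ∎
      where open ≤-Reasoning

    0<b : ¬ Q ∣ h → 0 < b
    0<b Q∤h = n≢0⇒n>0 λ b≡0 → coprime-∤-p^k* (p^suc[m]+1-coprime-p p f₀) Q∤h k
                (m%n≡0⇒n∣m (P * h) Q (trans (sym (mod'≡% (P * h) Q)) b≡0))

    digitSum≡Qαₖ+b : ¬ Q ∣ h → digitSum i ≡ Q * αₖ + b
    digitSum≡Qαₖ+b Q∤h = trans digitSum≡rotation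
      (≡-mod⇒≡-≤ S≤QR (≤-trans (0<b Q∤h) (m≤n+m b (Q * αₖ))) Qαₖ+b<QR S≡Qαₖ+b-mod-QR)

    ν<αₖ⇔threshold≤digitSum : ¬ Q ∣ h → ν p f < αₖ ⇔ div' (q p f ^ 2 ∸ 1) (p ∸ 1) ≤ digitSum i
    ν<αₖ⇔threshold≤digitSum Q∤h =
      subst₂ (λ t s → ν p f < αₖ ⇔ t ≤ s) (sym (threshold≡[q+1]*suc[ν] c f₀)) (sym (digitSum≡Qαₖ+b Q∤h))
        (m<n⇔o*suc[m]≤o*n+r b<Q)

ι≤1 : ∀ p f h γ′ i → ι p f h γ′ i ≤ 1
ι≤1 p f h γ′ i with hSeq p f h γ′ i ≡ᵇ (p ∸ 1)
... | true  = ≤-refl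
... | false = z≤n

lemmaB1p1 : (p f : ℕ) → Prime p → 2 < p → 2 ≤ f →
    (h γ γ' : ℕ) → Coherent p f h γ γ' →
    (i : ℤ) →
    (gene p f h γ' i ≡ O)
      ⇔ (div' (q p f ^ 2 ∸ 1) (p ∸ 1)
           ≤ sumTo (2 * f) (λ j → p ^ (2 * f ∸ 1 ∸ j) * v p f h γ' (i Data.Integer.+ + j)))
lemmaB1p1 zero                _                   _ ()             _                 _ _ _ _ _
lemmaB1p1 (suc zero)          _                   _ (s≤s ())       _                 _ _ _ _ _
lemmaB1p1 (suc (suc c))       zero                _ _              ()                _ _ _ _ _
lemmaB1p1 (suc (suc c))       (suc zero)          _ _              (s≤s ())          _ _ _ _ _
lemmaB1p1 p@(suc (suc c))     f@(suc (suc f₀))    _ _              _ h _ γ′ coherent i =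
  ⇔.trans (geneSymbol≡O⇔ν<α {lower = div' (ν p f) p} {ι = ι p f h γ′ k} {ι′ = ι p f h γ′ (k + f)}
                             lower+ι′≤ν ([p∸1]*m/p≤m p (ν p f)))
          (CyclicDigitSum.ν<αₖ⇔threshold≤digitSum (suc c) (suc f₀) h γ′ i (Coherent.notDiv coherent))
  where
  k : ℕ
  k = modℤ i (2 * f)
  lower+ι′≤ν : div' (ν p f) p + ι p f h γ′ (k + f) ≤ ν p f
  lower+ι′≤ν = ≤-trans (+-monoʳ-≤ _ (ι≤1 p f h γ′ (k + f)))
                       (subst (_≤ ν p f) (+-comm 1 _) (ν/p<ν p f₀ (s≤s (s≤s z≤n))))
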